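{- Let $b$ be a positive integer, $q$ an odd prime, and $K$ an integral $\mathbb Z_q$-lattice with quadratic map $Q$ such that $b\mathbb Z_q\subseteq Q(K)\subsetneq\mathbb Z_q$. Let $\Lambda_q(K)=\{\mathbf x\in K: Q(\mathbf x+\mathbf z)\equiv Q(\mathbf z)\pmod{q\mathbb Z_q}\text{ for all }\mathbf z\in K\}$, suppose $\delta\in\{1,2\}$ is such that the scale of $\Lambda_q(K)$ equals $q^{\delta}\mathbb Z_q$, and let $\lambda_q(K)$ be the lattice $\Lambda_q(K)$ with quadratic map $q^{ -\delta}Q$ (so that $\lambda_q(K)$ is primitive). Then $b\mathbb Z_q\subseteq Q(\Lambda_q(K))\subseteq q^{\delta}\mathbb Z_q$. In particular, $b$ is divisible by $q^{\delta}$ and $bq^{ -\delta}\mathbb Z_q\subseteq Q(\lambda_q(K))$.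
   Context: For a $\mathbb Z_q$-lattice $L$ with quadratic map $Q$ and bilinear form $B(\mathbf x,\mathbf y)=\frac12(Q(\mathbf x+\mathbf y)-Q(\mathbf x)-Q(\mathbf y))$, $Q(L)=\{Q(\mathbf v):\mathbf v\in L\}$; the scale of $L$ is the $\mathbb Z_q$-module generated by $B(L,L)$; $L$ is integral if its scale is contained in $\mathbb Z_q$ and primitive if its scale equals $\mathbb Z_q$. -}

module Defs where

open import Data.Nat as ℕ using (ℕ; zero; suc)
open import Data.Integer as ℤ using (ℤ; +_; _+_; _-_; _*_; -_)
open import Data.Integer.Divisibility.Signed using (_∣_; divides; ∣m∣n⇒∣m+n; ∣m⇒∣-m; ∣n⇒∣m*n; ∣m⇒∣m*n)
open import Data.Integer.Tactic.RingSolver using (solve-∀)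
open import Data.Fin using (Fin; zero; suc)
open import Data.Product using (Σ; _×_; _,_; ∃)
open import Relation.Binary.PropositionalEquality using (_≡_; refl; subst; sym)

-- ℤ_q as the inverse limit lim ℤ/q^n ℤ: a sequence of integers whose
-- n-th term represents a class mod q^n, the classes being compatible.

record ℤ[_] (q : ℕ) : Set where
  constructor mkℤq
  field
    approx : ℕ → ℤ
    coh    : ∀ n → + (q ℕ.^ n) ∣ (approx (suc n) - approx n)
open ℤ[_] public

private
  sub-add : ∀ a' a b' b → (a' + b') - (a + b) ≡ (a' - a) + (b' - b)
  sub-add = solve-∀
  sub-mul : ∀ a' a b' b → a' * b' - a * b ≡ a' * (b' - b) + (a' - a) * b
  sub-mul = solve-∀
  sub-neg : ∀ a' a → (- a') - (- a) ≡ - (a' - a)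
  sub-neg = solve-∀
  sub-self : ∀ a → a - a ≡ + 0 * a
  sub-self = solve-∀

module _ {q : ℕ} where

  infix 4 _≈_
  _≈_ : ℤ[ q ] → ℤ[ q ] → Set
  x ≈ y = ∀ n → + (q ℕ.^ n) ∣ (approx x n - approx y n)

  ι : ℤ → ℤ[ q ]
  ι a = mkℤq (λ _ → a) (λ n → divides (+ 0) (subst (λ t → t ≡ + 0 * + (q ℕ.^ n)) (sym (sub-self a)) refl))

  0q 1q : ℤ[ q ]
  0q = ι (+ 0)
  1q = ι (+ 1)

  infixl 6 _+q_
  infixl 7 _*q_
  _+q_ : ℤ[ q ] → ℤ[ q ] → ℤ[ q ]
  x +q y = mkℤq (λ n → approx x n + approx y n)
    (λ n → subst (+ (q ℕ.^ n) ∣_)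
      (sym (sub-add (approx x (suc n)) (approx x n) (approx y (suc n)) (approx y n)))
      (∣m∣n⇒∣m+n (coh x n) (coh y n)))

  _*q_ : ℤ[ q ] → ℤ[ q ] → ℤ[ q ]
  x *q y = mkℤq (λ n → approx x n * approx y n)
    (λ n → subst (+ (q ℕ.^ n) ∣_)
      (sym (sub-mul (approx x (suc n)) (approx x n) (approx y (suc n)) (approx y n)))
      (∣m∣n⇒∣m+n (∣n⇒∣m*n (approx x (suc n)) (coh y n)) (∣m⇒∣m*n (approx y n) (coh x n))))

  -q_ : ℤ[ q ] → ℤ[ q ]
  -q x = mkℤq (λ n → - approx x n)
    (λ n → subst (+ (q ℕ.^ n) ∣_) (sym (sub-neg (approx x (suc n)) (approx x n))) (∣m⇒∣-m (coh x n)))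

  infixl 6 _-q_
  _-q_ : ℤ[ q ] → ℤ[ q ] → ℤ[ q ]
  x -q y = x +q (-q y)

  _∈q^_ℤq : ℤ[ q ] → ℕ → Set
  a ∈q^ k ℤq = Σ ℤ[ q ] λ c → a ≈ ι (+ (q ℕ.^ k)) *q c

  Σq : ∀ {n} → (Fin n → ℤ[ q ]) → ℤ[ q ]
  Σq {zero}  f = 0q
  Σq {suc n} f = f zero +q Σq (λ i → f (suc i))

-- An integral ℤ_q-lattice of rank n: the free module ℤ_q^n with a
-- symmetric bilinear form B given by a symmetric Gram matrix with
-- entries in ℤ_q (integrality), and quadratic map Q(x) = B(x,x).

Vecq : ℕ → ℕ → Set
Vecq q n = Fin n → ℤ[ q ]

record Lattice (q n : ℕ) : Set where
  field
    gram      : Fin n → Fin n → ℤ[ q ]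
    symmetric : ∀ i j → gram i j ≈ gram j i
  B : Vecq q n → Vecq q n → ℤ[ q ]
  B x y = Σq (λ i → Σq (λ j → gram i j *q x i *q y j))
  Q : Vecq q n → ℤ[ q ]
  Q x = B x x
  field
    nondegenerate : ∀ (x : Vecq q n) → (∀ y → B x y ≈ 0q) → ∀ i → x i ≈ 0q

module _ {q n : ℕ} where

  _+v_ : Vecq q n → Vecq q n → Vecq q n
  (x +v z) i = x i +q z i

module LatticeNotions {q n : ℕ} (K : Lattice q n) where
  open Lattice K public

  QK : ℤ[ q ] → Set
  QK a = ∃ λ x → Q x ≈ a

  Λ : Vecq q n → Set
  Λ x = ∀ z → (Q (x +v z) -q Q z) ∈q^ 1 ℤq

  QΛ : ℤ[ q ] → Set
  QΛ a = ∃ λ x → Λ x × Q x ≈ a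

  BΛ : ℤ[ q ] → Set
  BΛ a = ∃ λ x → ∃ λ y → Λ x × Λ y × B x y ≈ a

  -- Q(λ_q(K)) where λ_q(K) is Λ_q(K) with quadratic map q^{-δ}Q:
  -- c ∈ Q(λ_q(K)) iff q^δ c = Q(x) for some x ∈ Λ_q(K)
  Qλ : ℕ → ℤ[ q ] → Set
  Qλ δ c = ∃ λ x → Λ x × Q x ≈ ι (+ (q ℕ.^ δ)) *q c

data Span {q : ℕ} (S : ℤ[ q ] → Set) : ℤ[ q ] → Set where
  span-zero : ∀ {a} → a ≈ 0q → Span S a
  span-step : ∀ {a r} (c s : ℤ[ q ]) → S s → Span S r → a ≈ c *q s +q r → Span S a

module Submission where

-- If q ∤ b, Hensel's lemma solves b s = a in ℤ_q for every a, and b ℤ_q ⊆ Q(K) then makes Q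
-- universal, contradicting Q(K) ≠ ℤ_q; so q ∣ b.  Now let Q(x) = b a, so that q ∣ Q(x).  For
-- every z,
--   Q(s x + z) = s² Q(x) + s (B(x,z) + B(z,x)) + Q(z)
-- is a quadratic in s whose leading coefficient lies in q ℤ_q; if its linear coefficient were a
-- unit, Hensel's lemma would again make Q universal.  Hence q divides
-- Q(x + z) − Q(z) = Q(x) + B(x,z) + B(z,x) for all z, i.e. x ∈ Λ_q(K), and b ℤ_q ⊆ Q(Λ_q(K)).
-- Finally Q(Λ_q(K)) ⊆ B(Λ_q(K), Λ_q(K)) ⊆ q^δ ℤ_q, and the remaining claims follow by taking
-- a = 1 and by cancelling q^δ.

open import Data.Fin as Fin using (Fin)
open import Data.Product using (Σ; _×_; _,_; ∃; proj₁; proj₂)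
open import Function.Base using (_∘_)
open import Relation.Binary.PropositionalEquality
  using (_≡_; refl; sym; trans; cong; cong₂; subst; subst₂; module ≡-Reasoning)
open import Relation.Nullary using (¬_)
open import Defs

module _ where
  open import Data.Empty using (⊥-elim)
  open import Data.Integer using (ℤ; +_; -_; _+_; _-_; _*_; ∣_∣)
  open import Data.Integer.Divisibility.Signed
  open import Data.Integer.Properties
    using (pos-+; pos-*; *-comm; *-assoc; *-zeroˡ; *-identityˡ; *-identityʳ; +-inverseʳ; +-minus-telescope;
           +∣i∣≡i⊎+∣i∣≡-i; +-*-semiring)
  open import Algebra.Properties.Semiring.Sum +-*-semiring using (sum; sum-cong-≗; ∑-distrib-+; *-distribˡ-sum)
  open import Data.Integer.Tactic.RingSolver using (solve-∀)
  import Data.Nat as ℕ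
  open ℕ using (ℕ; zero; suc)
  open import Data.Nat.Coprimality using (Coprime; coprime-Bézout)
  open import Data.Nat.GCD using (module Bézout)
  open import Data.Nat.Primality using (Prime; prime⇒irreducible; prime⇒nonZero)
  open import Data.Nat.Properties using () renaming (*-identityʳ to ℕ*-identityʳ)
  open import Data.Sum using (inj₁; inj₂)
  open import Relation.Nullary.Decidable using (decidable-stable)

  ∣i-i : ∀ k i → k ∣ i - i
  ∣i-i k i = divides (+ 0) (trans (+-inverseʳ i) (sym (*-zeroˡ k)))

  ∣i-j⇒∣j-i : ∀ {k i j} → k ∣ i - j → k ∣ j - i
  ∣i-j⇒∣j-i {k} {i} {j} k∣i-j = subst (k ∣_) (neg-minus i j) (∣m⇒∣-m k∣i-j)
    where
    neg-minus : ∀ i j → - (i - j) ≡ j - i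
    neg-minus = solve-∀

  ∣i-j∧∣j-l⇒∣i-l : ∀ {k i j l} → k ∣ i - j → k ∣ j - l → k ∣ i - l
  ∣i-j∧∣j-l⇒∣i-l {k} {i} {j} {l} p r = subst (k ∣_) (+-minus-telescope i j l) (∣m∣n⇒∣m+n p r)

  ∣i-j∧∣j⇒∣i : ∀ {k i j} → k ∣ i - j → k ∣ j → k ∣ i
  ∣i-j∧∣j⇒∣i {k} {i} {j} p r = subst (k ∣_) (minus-plus i j) (∣m∣n⇒∣m+n p r)
    where
    minus-plus : ∀ i j → i - j + j ≡ i
    minus-plus = solve-∀

  1∣i : ∀ i → + 1 ∣ i
  1∣i i = divides i (sym (*-identityʳ i))

  -- ℤ_q

  module _ {q : ℕ} where

    qℤ^ : ℕ → ℤ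
    qℤ^ n = + (q ℕ.^ n)

    qℤ^-suc : ∀ n → qℤ^ (suc n) ≡ qℤ^ n * + q
    qℤ^-suc n = trans (pos-* q (q ℕ.^ n)) (*-comm (+ q) (qℤ^ n))

    q∣qℤ^-suc : ∀ n → + q ∣ qℤ^ (suc n)
    q∣qℤ^-suc n = divides (qℤ^ n) (qℤ^-suc n)

    ≈-pointwise : {x y : ℤ[ q ]} → (∀ n → approx x n ≡ approx y n) → x ≈ y
    ≈-pointwise {x} x≡y n = subst (λ t → qℤ^ n ∣ approx x n - t) (x≡y n) (∣i-i (qℤ^ n) (approx x n))

    ≈-refl : {x : ℤ[ q ]} → x ≈ x
    ≈-refl {x} = ≈-pointwise {x} {x} (λ _ → refl)

    ≈-sym : {x y : ℤ[ q ]} → x ≈ y → y ≈ x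
    ≈-sym {x} {y} x≈y n = ∣i-j⇒∣j-i {i = approx x n} {approx y n} (x≈y n)

    ≈-trans : {x y z : ℤ[ q ]} → x ≈ y → y ≈ z → x ≈ z
    ≈-trans {x} {y} {z} x≈y y≈z n = ∣i-j∧∣j-l⇒∣i-l {i = approx x n} {approx y n} {approx z n} (x≈y n) (y≈z n)

    residue : ℤ[ q ] → ℤ
    residue x = approx x 1

    q∣approx-suc-residue : ∀ x n → + q ∣ approx x (suc n) - residue x
    q∣approx-suc-residue x zero    = ∣i-i (+ q) (residue x)
    q∣approx-suc-residue x (suc n) =
      ∣i-j∧∣j-l⇒∣i-l {i = approx x (2 ℕ.+ n)} (∣-trans (q∣qℤ^-suc n) (coh x (suc n))) (q∣approx-suc-residue x n)

    q∣residue⇒q∣approx-suc : ∀ {x} → + q ∣ residue x → ∀ n → + q ∣ approx x (suc n)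
    q∣residue⇒q∣approx-suc {x} q∣x n = ∣i-j∧∣j⇒∣i {i = approx x (suc n)} (q∣approx-suc-residue x n) q∣x

    q∣residue-resp-≈ : ∀ {x y} → x ≈ y → + q ∣ residue y → + q ∣ residue x
    q∣residue-resp-≈ {x} x≈y = ∣i-j∧∣j⇒∣i {i = residue x} (∣-trans (q∣qℤ^-suc 0) (x≈y 1))

    ∈q^⇒q^∣approx : ∀ {a k} → a ∈q^ k ℤq → qℤ^ k ∣ approx a k
    ∈q^⇒q^∣approx {a} {k} (c , a≈q^c) = ∣i-j∧∣j⇒∣i {i = approx a k} (a≈q^c k) (∣m⇒∣m*n (approx c k) ∣-refl)

    ι-multiple-∈q^⇒∣ : ∀ {m k} → (ι (+ m) *q 1q) ∈q^ k ℤq → qℤ^ k ∣ + m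
    ι-multiple-∈q^⇒∣ {m} {k} m∈q^k = subst (qℤ^ k ∣_) (*-identityʳ (+ m)) (∈q^⇒q^∣approx {a = ι (+ m) *q 1q} {k} m∈q^k)

    ι-factor : ∀ {m m₁ m₂} → m ≡ m₁ ℕ.* m₂ → ∀ (a : ℤ[ q ]) → ι (+ m) *q a ≈ ι (+ m₁) *q (ι (+ m₂) *q a)
    ι-factor {m₁ = m₁} {m₂} refl a = ≈-pointwise {x = ι (+ (m₁ ℕ.* m₂)) *q a} {ι (+ m₁) *q (ι (+ m₂) *q a)} λ k →
      trans (cong (_* approx a k) (pos-* m₁ m₂)) (*-assoc (+ m₁) (+ m₂) (approx a k))

    q∣residue⇒∈qℤq : .{{ℕ.NonZero q}} → ∀ {w} → + q ∣ residue w → w ∈q^ 1 ℤq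
    q∣residue⇒∈qℤq {w} q∣w = w/q , w≈q*w/q
      where
      q∣w-suc : ∀ n → + q ∣ approx w (suc n)
      q∣w-suc = q∣residue⇒q∣approx-suc {w} q∣w

      c : ℕ → ℤ
      c n = quotient (q∣w-suc n)

      w-suc≡c*q : ∀ n → approx w (suc n) ≡ c n * + q
      w-suc≡c*q n = _∣_.equality (q∣w-suc n)

      factor : ∀ a b k → a * k - b * k ≡ (a - b) * k
      factor = solve-∀

      w/q : ℤ[ q ]
      w/q = mkℤq c λ n → *-cancelʳ-∣ (+ q)
        (subst₂ _∣_ (qℤ^-suc n)
          (trans (cong₂ _-_ (w-suc≡c*q (suc n)) (w-suc≡c*q n)) (factor (c (suc n)) (c n) (+ q)))
          (coh w (suc n)))

      q*c≡w : ∀ n → + (q ℕ.* 1) * c (suc n) ≡ approx w (2 ℕ.+ n)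
      q*c≡w n = trans (cong (λ m → + m * c (suc n)) (ℕ*-identityʳ q))
                  (trans (*-comm (+ q) (c (suc n))) (sym (w-suc≡c*q (suc n))))

      w≈q*w/q : w ≈ ι (+ (q ℕ.^ 1)) *q w/q
      w≈q*w/q zero    = divides (approx w 0 - + (q ℕ.* 1) * c 0) (sym (*-identityʳ _))
      w≈q*w/q (suc n) = subst (λ t → qℤ^ (suc n) ∣ approx w (suc n) - t) (sym (q*c≡w n))
                          (∣i-j⇒∣j-i {i = approx w (2 ℕ.+ n)} (coh w (suc n)))

  -- Hensel's lemma

  quadratic : ℤ → ℤ → ℤ → ℤ → ℤ
  quadratic A E C s = A * s * s + E * s - C

  quadratic-congruent : ∀ {k A A′ E E′ C C′} s → k ∣ A′ - A → k ∣ E′ - E → k ∣ C′ - C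
                      → k ∣ quadratic A E C s → k ∣ quadratic A′ E′ C′ s
  quadratic-congruent {k} {A} {A′} {E} {E′} {C} {C′} s k∣ΔA k∣ΔE k∣ΔC k∣f =
    subst (k ∣_) (split A A′ E E′ C C′ s)
      (∣m∣n⇒∣m+n k∣f (∣m∣n⇒∣m+n (∣m∣n⇒∣m+n (∣m⇒∣m*n s (∣m⇒∣m*n s k∣ΔA)) (∣m⇒∣m*n s k∣ΔE)) (∣m⇒∣-m k∣ΔC)))
    where
    split : ∀ A A′ E E′ C C′ s
          → A * s * s + E * s - C + ((A′ - A) * s * s + (E′ - E) * s + - (C′ - C))
            ≡ A′ * s * s + E′ * s - C′
    split = solve-∀

  -- Newton's step s ↦ s − f(s) e: as k ∣ A, the derivative 2 A s + E of f is E mod k, and e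
  -- inverts it mod k.
  newton-step : ∀ {k} p A E C s m e → k ∣ A → k ∣ e * E - + 1 → quadratic A E C s ≡ m * p
              → p * k ∣ quadratic A E C (s + p * - (m * e))
  newton-step {k} p A E C s m e k∣A k∣eE-1 f≡mp =
    subst (p * k ∣_) (sym f[s′]≡pX) (*-monoʳ-∣ p (∣m∣n⇒∣m+n (∣n⇒∣m*n (- m) k∣eE-1) (∣m⇒∣m*n _ k∣A)))
    where
    open ≡-Reasoning
    X : ℤ
    X = - m * (e * E - + 1) + A * (p * m * m * e * e - (m * e * s + m * e * s))
    taylor : ∀ A E C s m e p
           → A * (s + p * - (m * e)) * (s + p * - (m * e)) + E * (s + p * - (m * e)) - C
           ≡ (A * s * s + E * s - C - m * p)
             + p * (- m * (e * E - + 1) + A * (p * m * m * e * e - (m * e * s + m * e * s)))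
    taylor = solve-∀
    cancel : ∀ a b → a - a + b ≡ b
    cancel = solve-∀
    f[s′]≡pX : quadratic A E C (s + p * - (m * e)) ≡ p * X
    f[s′]≡pX = begin
      quadratic A E C (s + p * - (m * e)) ≡⟨ taylor A E C s m e p ⟩
      quadratic A E C s - m * p + p * X   ≡⟨ cong (λ t → t - m * p + p * X) f≡mp ⟩
      m * p - m * p + p * X               ≡⟨ cancel (m * p) (p * X) ⟩
      p * X                               ∎

  lift-to-ℤ : ∀ a b c d e → a ℕ.+ b ℕ.* c ≡ d ℕ.* e → + a + + b * + c ≡ + d * + e
  lift-to-ℤ a b c d e eq = begin
    + a + + b * + c     ≡⟨ cong (_+_ (+ a)) (sym (pos-* b c)) ⟩
    + a + + (b ℕ.* c)   ≡⟨ sym (pos-+ a (b ℕ.* c)) ⟩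
    + (a ℕ.+ b ℕ.* c)   ≡⟨ cong +_ eq ⟩
    + (d ℕ.* e)         ≡⟨ pos-* d e ⟩
    + d * + e           ∎
    where open ≡-Reasoning

  module _ {q : ℕ} (q-prime : Prime q) where

    prime-coprime-to-non-multiple : ∀ {E} → ¬ (+ q ∣ E) → Coprime q ∣ E ∣
    prime-coprime-to-non-multiple q∤E {d} (d∣q , d∣E) with prime⇒irreducible q-prime d∣q
    ... | inj₁ d≡1 = d≡1
    ... | inj₂ refl = ⊥-elim (q∤E (∣ᵤ⇒∣ d∣E))

    inverse-mod-coprime : ∀ {F} → Coprime q F → ∃ λ e → + q ∣ e * + F - + 1
    inverse-mod-coprime {F} q⊥F with coprime-Bézout q⊥F
    ... | Bézout.+- x y 1+yF≡xq = - + y , divides (- + x) (begin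
            - + y * + F - + 1     ≡⟨ negate-sum (+ y) (+ F) ⟩
            - (+ 1 + + y * + F)   ≡⟨ cong -_ (lift-to-ℤ 1 y F x q 1+yF≡xq) ⟩
            - (+ x * + q)         ≡⟨ negate-product (+ x) (+ q) ⟩
            - + x * + q           ∎)
      where
      open ≡-Reasoning
      negate-sum : ∀ a b → - a * b - + 1 ≡ - (+ 1 + a * b)
      negate-sum = solve-∀
      negate-product : ∀ a b → - (a * b) ≡ - a * b
      negate-product = solve-∀
    ... | Bézout.-+ x y 1+xq≡yF = + y , divides (+ x) (begin
            + y * + F - + 1             ≡⟨ cong (_- + 1) (sym (lift-to-ℤ 1 x q y F 1+xq≡yF)) ⟩
            + 1 + + x * + q - + 1       ≡⟨ cancel (+ x * + q) ⟩
            + x * + q                   ∎)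
      where
      open ≡-Reasoning
      cancel : ∀ a → + 1 + a - + 1 ≡ a
      cancel = solve-∀

    inverse-mod-prime : ∀ {E} → ¬ (+ q ∣ E) → ∃ λ e → + q ∣ e * E - + 1
    inverse-mod-prime {E} q∤E with inverse-mod-coprime (prime-coprime-to-non-multiple q∤E) | +∣i∣≡i⊎+∣i∣≡-i E
    ... | e , q∣e∣E∣-1 | inj₁ ∣E∣≡E  = e , subst (λ t → + q ∣ e * t - + 1) ∣E∣≡E q∣e∣E∣-1
    ... | e , q∣e∣E∣-1 | inj₂ ∣E∣≡-E =
      - e , subst (+ q ∣_) (move-sign e E) (subst (λ t → + q ∣ e * t - + 1) ∣E∣≡-E q∣e∣E∣-1)
      where
      move-sign : ∀ e E → e * - E - + 1 ≡ - e * E - + 1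
      move-sign = solve-∀

    hensel : ∀ (α β c : ℤ[ q ]) → + q ∣ residue α → ¬ (+ q ∣ residue β)
           → ∃ λ s → α *q s *q s +q β *q s ≈ c
    hensel α β c q∣α q∤β = root , λ n → proj₂ (roots n)
      where
      e : ℤ
      e = proj₁ (inverse-mod-prime q∤β)

      q∣eβ-1 : ∀ n → + q ∣ e * approx β (suc n) - + 1
      q∣eβ-1 n = subst (+ q ∣_) (regroup e (approx β (suc n)) (residue β))
        (∣m∣n⇒∣m+n (∣n⇒∣m*n e (q∣approx-suc-residue β n)) (proj₂ (inverse-mod-prime q∤β)))
        where
        regroup : ∀ e b b₁ → e * (b - b₁) + (e * b₁ - + 1) ≡ e * b - + 1
        regroup = solve-∀

      f : ℕ → ℤ → ℤ
      f n = quadratic (approx α n) (approx β n) (approx c n)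

      ApproximateRoot : ℕ → Set
      ApproximateRoot n = Σ ℤ λ s → qℤ^ n ∣ f n s

      raise-level : ∀ n s → qℤ^ n ∣ f n s → qℤ^ n ∣ f (suc n) s
      raise-level n s = quadratic-congruent {A = approx α n} {approx α (suc n)} {approx β n} {approx β (suc n)}
                          {approx c n} {approx c (suc n)} s (coh α n) (coh β n) (coh c n)

      correction : ∀ n → ApproximateRoot n → ℤ
      correction n (s , r) = - (quotient (raise-level n s r) * e)

      newton-lift : ∀ n → ApproximateRoot n → ApproximateRoot (suc n)
      newton-lift n (s , r) = s + qℤ^ n * correction n (s , r) ,
        subst (_∣ f (suc n) (s + qℤ^ n * correction n (s , r))) (sym (qℤ^-suc n))
          (newton-step (qℤ^ n) (approx α (suc n)) (approx β (suc n)) (approx c (suc n)) s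
            (quotient (raise-level n s r)) e
            (q∣residue⇒q∣approx-suc {x = α} q∣α n) (q∣eβ-1 n) (_∣_.equality (raise-level n s r)))

      roots : ∀ n → ApproximateRoot n
      roots zero    = + 0 , 1∣i (f 0 (+ 0))
      roots (suc n) = newton-lift n (roots n)

      root : ℤ[ q ]
      root = mkℤq (λ n → proj₁ (roots n))
        (λ n → divides (correction n (roots n)) (step (proj₁ (roots n)) (qℤ^ n) (correction n (roots n))))
        where
        step : ∀ s p t → s + p * t - s ≡ t * p
        step = solve-∀

  -- Bilinear forms

  sum-affine : ∀ {m} a (f g : Fin m → ℤ) → sum (λ i → a * f i + g i) ≡ a * sum f + sum g
  sum-affine a f g = trans (∑-distrib-+ (λ i → a * f i) g) (cong (_+ sum g) (sym (*-distribˡ-sum a f)))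

  form : ∀ {m} → (Fin m → Fin m → ℤ) → (Fin m → ℤ) → (Fin m → ℤ) → ℤ
  form G u v = sum λ i → sum λ j → G i j * u i * v j

  module _ {m} (G : Fin m → Fin m → ℤ) where

    form-linearˡ : ∀ {u} a x z v → (∀ i → u i ≡ a * x i + z i) → form G u v ≡ a * form G x v + form G z v
    form-linearˡ {u} a x z v u≡ax+z = trans (sum-cong-≗ row) (sum-affine {m} a _ _)
      where
      distrib : ∀ g u a x z v → u ≡ a * x + z → g * u * v ≡ a * (g * x * v) + g * z * v
      distrib g u a x z v refl = expand g a x z v
        where
        expand : ∀ g a x z v → g * (a * x + z) * v ≡ a * (g * x * v) + g * z * v
        expand = solve-∀
      row : ∀ i → sum (λ j → G i j * u i * v j) ≡ a * sum (λ j → G i j * x i * v j) + sum (λ j → G i j * z i * v j)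
      row i = trans (sum-cong-≗ (λ j → distrib (G i j) _ a (x i) (z i) (v j) (u≡ax+z i))) (sum-affine {m} a _ _)

    form-linearʳ : ∀ {v} a u x z → (∀ j → v j ≡ a * x j + z j) → form G u v ≡ a * form G u x + form G u z
    form-linearʳ {v} a u x z v≡ax+z = trans (sum-cong-≗ row) (sum-affine {m} a _ _)
      where
      distrib : ∀ g u v a x z → v ≡ a * x + z → g * u * v ≡ a * (g * u * x) + g * u * z
      distrib g u v a x z refl = expand g u a x z
        where
        expand : ∀ g u a x z → g * u * (a * x + z) ≡ a * (g * u * x) + g * u * z
        expand = solve-∀
      row : ∀ i → sum (λ j → G i j * u i * v j) ≡ a * sum (λ j → G i j * u i * x j) + sum (λ j → G i j * u i * z j)
      row i = trans (sum-cong-≗ (λ j → distrib (G i j) (u i) _ a (x j) (z j) (v≡ax+z j))) (sum-affine {m} a _ _)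

    form-expand : ∀ {y} σ x z → (∀ i → y i ≡ σ * x i + z i)
                → form G y y ≡ σ * σ * form G x x + σ * (form G x z + form G z x) + form G z z
    form-expand {y} σ x z y≡σx+z = begin
      form G y y                                                  ≡⟨ form-linearˡ σ x z y y≡σx+z ⟩
      σ * form G x y + form G z y                                 ≡⟨ cong₂ (λ a b → σ * a + b)
                                                                       (form-linearʳ σ x x z y≡σx+z)
                                                                       (form-linearʳ σ z x z y≡σx+z) ⟩
      σ * (σ * form G x x + form G x z) + (σ * form G z x + form G z z) ≡⟨ regroup σ _ _ _ _ ⟩
      σ * σ * form G x x + σ * (form G x z + form G z x) + form G z z ∎
      where
      open ≡-Reasoning
      regroup : ∀ σ a b c d → σ * (σ * a + b) + (σ * c + d) ≡ σ * σ * a + σ * (b + c) + d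
      regroup = solve-∀

  approx-Σq : ∀ {q m} (f : Fin m → ℤ[ q ]) k → approx (Σq f) k ≡ sum (λ i → approx (f i) k)
  approx-Σq {m = zero}  f k = refl
  approx-Σq {m = suc m} f k = cong (_+_ (approx (f Fin.zero) k)) (approx-Σq (f ∘ Fin.suc) k)

  module _ {q n} (K : Lattice q n) where
    open LatticeNotions K

    approx-B : ∀ u v k → approx (B u v) k
             ≡ form (λ i j → approx (gram i j) k) (λ i → approx (u i) k) (λ i → approx (v i) k)
    approx-B u v k = trans (approx-Σq {q} {n} _ k) (sum-cong-≗ {n} (λ i → approx-Σq {q} {n} _ k))

    approx-Q-expand : ∀ {y} σ x z k → (∀ i → approx (y i) k ≡ σ * approx (x i) k + approx (z i) k)
                    → approx (Q y) k ≡ σ * σ * approx (Q x) k + σ * approx (B x z +q B z x) k + approx (Q z) k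
    approx-Q-expand {y} σ x z k y≡σx+z = begin
      approx (Q y) k                                             ≡⟨ approx-B y y k ⟩
      form Gₖ (at y) (at y)                                      ≡⟨ form-expand Gₖ σ (at x) (at z) y≡σx+z ⟩
      σ * σ * form Gₖ (at x) (at x) + σ * (form Gₖ (at x) (at z) + form Gₖ (at z) (at x)) + form Gₖ (at z) (at z)
        ≡⟨ sym (cong₂ (λ a b → σ * σ * a + σ * b + form Gₖ (at z) (at z))
                  (approx-B x x k) (cong₂ _+_ (approx-B x z k) (approx-B z x k))) ⟩
      σ * σ * approx (Q x) k + σ * approx (B x z +q B z x) k + form Gₖ (at z) (at z)
        ≡⟨ cong (_+_ (σ * σ * approx (Q x) k + σ * approx (B x z +q B z x) k)) (sym (approx-B z z k)) ⟩
      σ * σ * approx (Q x) k + σ * approx (B x z +q B z x) k + approx (Q z) k ∎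
      where
      open ≡-Reasoning
      Gₖ : Fin n → Fin n → ℤ
      Gₖ i j = approx (gram i j) k
      at : Vecq q n → Fin n → ℤ
      at u i = approx (u i) k

    QΛ-multiple⇒Qλ : ∀ {m m′} δ → m ≡ q ℕ.^ δ ℕ.* m′ → ∀ a → QΛ (ι (+ m) *q a) → Qλ δ (ι (+ m′) *q a)
    QΛ-multiple⇒Qλ {m} {m′} δ m≡q^δm′ a (x , Λx , Qx≈ma) =
      x , Λx , ≈-trans {x = Q x} {ι (+ m) *q a} {ι (+ (q ℕ.^ δ)) *q (ι (+ m′) *q a)} Qx≈ma
                 (ι-factor {m = m} {q ℕ.^ δ} {m′} m≡q^δm′ a)

    QΛ⊆Span-BΛ : ∀ {a} → QΛ a → Span BΛ a
    QΛ⊆Span-BΛ {a} (x , Λx , Qx≈a) =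
      span-step {r = 0q} 1q (Q x) (x , x , Λx , Λx , ≈-refl {x = Q x}) (span-zero (≈-refl {x = 0q}))
        (≈-trans {x = a} {Q x} {1q *q Q x +q 0q} (≈-sym {x = Q x} {a} Qx≈a)
          (≈-pointwise {x = Q x} {1q *q Q x +q 0q} λ k → sym (unit-plus-zero (approx (Q x) k))))
      where
      unit-plus-zero : ∀ a → + 1 * a + + 0 ≡ a
      unit-plus-zero = solve-∀

  module _ {q n} (K : Lattice q n) (q-prime : Prime q) where
    open LatticeNotions K

    universal-if-q∤b : ∀ {b} → (∀ a → QK (ι (+ b) *q a)) → ¬ (+ q ∣ + b) → ∀ a → QK a
    universal-if-q∤b {b} b·ℤq⊆QK q∤b a = x , ≈-trans {x = Q x} {ι (+ b) *q s} {a} Qx≈bs bs≈a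
      where
      root : ∃ λ s → 0q *q s *q s +q ι (+ b) *q s ≈ a
      root = hensel q-prime 0q (ι (+ b)) a (divides (+ 0) refl) q∤b
      s : ℤ[ q ]
      s = proj₁ root
      x : Vecq q n
      x = proj₁ (b·ℤq⊆QK s)
      Qx≈bs : Q x ≈ ι (+ b) *q s
      Qx≈bs = proj₂ (b·ℤq⊆QK s)
      add-zero : ∀ b s → b * s ≡ + 0 * s * s + b * s
      add-zero = solve-∀
      bs≈a : ι (+ b) *q s ≈ a
      bs≈a = ≈-trans {x = ι (+ b) *q s} {0q *q s *q s +q ι (+ b) *q s} {a}
               (≈-pointwise {x = ι (+ b) *q s} {0q *q s *q s +q ι (+ b) *q s} λ k → add-zero (+ b) (approx s k))
               (proj₂ root)

    universal-if-q∤cross-term : ∀ x z → + q ∣ residue (Q x) → ¬ (+ q ∣ residue (B x z +q B z x)) → ∀ a → QK a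
    universal-if-q∤cross-term x z q∣Qx q∤Bxz a = y , Qy≈a
      where
      root : ∃ λ s → Q x *q s *q s +q (B x z +q B z x) *q s ≈ a -q Q z
      root = hensel q-prime (Q x) (B x z +q B z x) (a -q Q z) q∣Qx q∤Bxz
      s : ℤ[ q ]
      s = proj₁ root
      y : Vecq q n
      y i = s *q x i +q z i
      regroup : ∀ s α β a c → α * s * s + β * s - (a - c) ≡ s * s * α + s * β + c - a
      regroup = solve-∀
      Qy-a : ∀ k → approx (Q x) k * approx s k * approx s k + approx (B x z +q B z x) k * approx s k
                   - (approx a k - approx (Q z) k)
                 ≡ approx (Q y) k - approx a k
      Qy-a k = trans (regroup (approx s k) (approx (Q x) k) (approx (B x z +q B z x) k) (approx a k) (approx (Q z) k))
                     (cong (_- approx a k) (sym (approx-Q-expand K {y} (approx s k) x z k (λ _ → refl))))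
      Qy≈a : Q y ≈ a
      Qy≈a k = subst (qℤ^ k ∣_) (Qy-a k) (proj₂ root k)

    Λ-if-q∣residue : ¬ (∀ a → QK a) → ∀ {x} → + q ∣ residue (Q x) → Λ x
    Λ-if-q∣residue not-universal {x} q∣Qx z =
      q∣residue⇒∈qℤq {{prime⇒nonZero q-prime}} {Q (x +v z) -q Q z}
        (subst (+ q ∣_) (sym difference) (∣m∣n⇒∣m+n q∣Qx q∣Bxz))
      where
      q∣Bxz : + q ∣ residue (B x z +q B z x)
      q∣Bxz = decidable-stable (+ q ∣? residue (B x z +q B z x)) (not-universal ∘ universal-if-q∤cross-term x z q∣Qx)
      cancel : ∀ Qx Bxz Qz → + 1 * + 1 * Qx + + 1 * Bxz + Qz - Qz ≡ Qx + Bxz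
      cancel = solve-∀
      difference : residue (Q (x +v z) -q Q z) ≡ residue (Q x) + residue (B x z +q B z x)
      difference = trans (cong (_- residue (Q z)) (approx-Q-expand K {x +v z} (+ 1) x z 1 x+z≡1x+z))
                         (cancel (residue (Q x)) (residue (B x z +q B z x)) (residue (Q z)))
        where
        x+z≡1x+z : ∀ i → approx (x i) 1 + approx (z i) 1 ≡ + 1 * approx (x i) 1 + approx (z i) 1
        x+z≡1x+z i = cong (_+ approx (z i) 1) (sym (*-identityˡ (approx (x i) 1)))

    multiples-in-QΛ : ∀ {b} → (∀ a → QK (ι (+ b) *q a)) → ¬ (∀ a → QK a) → ∀ a → QΛ (ι (+ b) *q a)
    multiples-in-QΛ {b} b·ℤq⊆QK not-universal a = x , Λ-if-q∣residue not-universal {x} q∣Qx , Qx≈ba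
      where
      x : Vecq q n
      x = proj₁ (b·ℤq⊆QK a)
      Qx≈ba : Q x ≈ ι (+ b) *q a
      Qx≈ba = proj₂ (b·ℤq⊆QK a)
      q∣b : + q ∣ + b
      q∣b = decidable-stable (+ q ∣? + b) (not-universal ∘ universal-if-q∤b b·ℤq⊆QK)
      q∣Qx : + q ∣ residue (Q x)
      q∣Qx = q∣residue-resp-≈ {x = Q x} {ι (+ b) *q a} Qx≈ba (∣m⇒∣m*n (residue a) q∣b)

open import Data.Integer using (+_)
open import Data.Integer.Divisibility.Signed using (∣⇒∣ᵤ)
open import Data.Nat using (ℕ; _≥_; _^_; _*_)
open import Data.Nat.Divisibility using (_∣_)
open import Data.Nat.Primality using (Prime)
open import Data.Sum using (_⊎_)
open import Function.Bundles using (_⇔_; Equivalence)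

lemma2p4 : (b q : ℕ) → b ≥ 1 → Prime q → ¬ (2 ∣ q)
    → (n : ℕ) (K : Lattice q n)
    → let open LatticeNotions K in
      (∀ a → QK (ι (+ b) *q a))
    → ¬ (∀ a → QK a)
    → (δ : ℕ) → (δ ≡ 1 ⊎ δ ≡ 2)
    → (∀ a → Span BΛ a ⇔ a ∈q^ δ ℤq)
    → (∀ a → QΛ (ι (+ b) *q a))
      × (∀ a → QΛ a → a ∈q^ δ ℤq)
      × (q ^ δ) ∣ b
      × (∀ b' → b ≡ q ^ δ * b' → ∀ a → Qλ δ (ι (+ b') *q a))
lemma2p4 b q _ q-prime _ n K b·ℤq⊆QK not-universal δ _ scale =
  QΛ-multiples , QΛ⊆q^δℤq , q^δ∣b , Qλ-multiples
  where
  open LatticeNotions K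

  QΛ-multiples : ∀ a → QΛ (ι (+ b) *q a)
  QΛ-multiples = multiples-in-QΛ K q-prime {b} b·ℤq⊆QK not-universal

  QΛ⊆q^δℤq : ∀ a → QΛ a → a ∈q^ δ ℤq
  QΛ⊆q^δℤq a = Equivalence.to (scale a) ∘ QΛ⊆Span-BΛ K

  q^δ∣b : q ^ δ ∣ b
  q^δ∣b = ∣⇒∣ᵤ (ι-multiple-∈q^⇒∣ {m = b} {δ} (QΛ⊆q^δℤq (ι (+ b) *q 1q) (QΛ-multiples 1q)))

  Qλ-multiples : ∀ b' → b ≡ q ^ δ * b' → ∀ a → Qλ δ (ι (+ b') *q a)
  Qλ-multiples b′ b≡q^δb′ a = QΛ-multiple⇒Qλ K δ b≡q^δb′ a (QΛ-multiples a)
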